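{- Let $F$ be a gene tree forest and $I(F)=(V,E)$ the modified edge-labeled graph associated to $F$. Then the cut-set function $f(I(F)):2^V\to\mathbb{R}$ is submodular.
   Context: A gene tree is a rooted binary tree (internal vertex $x$ has children $x_l,x_r$) whose leaves are labeled by genome labels (labels may repeat); a gene tree forest $F$ is a finite set of gene trees. $L(x)$ is the set of leaf labels in the subtree rooted at $x$, $L(F)$ the set of all leaf labels. An internal vertex $x$ is an apparent duplication if $L(x_l)\cap L(x_r)\neq\emptyset$. Label the internal vertices of $F$ injectively by $1,\dots,m$. The graph $I(F)$ has vertex set $V=L(F)$, and there is an edge between $s$ and $t$ labeled $a$ if and only if the internal vertex $x$ labeled $a$ satisfies either $\{s,t\}\subseteq L(x_l)$ or $\{s,t\}\subseteq L(x_r)$, or $\{s,t\}\subseteq L(x)$ and $x$ is not an apparent duplication. The cut-set function $f(H)$ of an edge-labeled graph $H$ on $V$ maps $X\subseteq V$ to the number of distinct labels on edges with one endpoint in $X$ and the other in $V\setminus X$. A function $f:2^V\to\mathbb{R}$ is submodular if $f(A)+f(B)\geq f(A\cup B)+f(A\cap B)$ for all $A,B\subseteq V$. -}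

module Defs where

open import Data.Nat using (ℕ; _≡ᵇ_; _+_; _≥_)
open import Data.Bool using (Bool; true; false; _∧_; _∨_; not)
open import Data.List using (List; []; _∷_; _++_; length; concatMap; lookup)
open import Data.Bool.ListAction using (any)
open import Data.Fin using (Fin)
open import Data.Fin.Subset using (Subset; ∣_∣)
open import Data.Vec using (tabulate)

-- Genome labels are natural numbers.
-- A gene tree: a rooted binary tree with labeled leaves (labels may repeat).
data GeneTree : Set where
  leaf : ℕ → GeneTree
  node : GeneTree → GeneTree → GeneTree

GeneForest : Set
GeneForest = List GeneTree

leafLabels : GeneTree → List ℕ
leafLabels (leaf g)   = g ∷ []
leafLabels (node l r) = leafLabels l ++ leafLabels r

forestLabels : GeneForest → List ℕ
forestLabels = concatMap leafLabels

_∈ᵇ_ : ℕ → List ℕ → Bool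
s ∈ᵇ xs = any (λ t → s ≡ᵇ t) xs

record Internal : Set where
  constructor int
  field
    left  : GeneTree
    right : GeneTree

-- All internal vertices of a tree / forest (each occurrence separately).
internals : GeneTree → List Internal
internals (leaf _)   = []
internals (node l r) = int l r ∷ (internals l ++ internals r)

forestInternals : GeneForest → List Internal
forestInternals = concatMap internals

apparentDup : Internal → Bool
apparentDup (int l r) = any (λ s → s ∈ᵇ leafLabels r) (leafLabels l)

-- An edge-labeled graph on a finite vertex set V ⊆ ℕ with labels 1..m
-- (represented as Fin m); edge a s t says there is an edge between s and t
-- labeled a.
record EdgeLabeledGraph : Set where
  field
    V     : List ℕ
    m     : ℕ
    edge  : Fin m → ℕ → ℕ → Bool

-- I(F): internal vertices labeled injectively by their position in
-- forestInternals F.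
edgeCond : Internal → ℕ → ℕ → Bool
edgeCond (int l r) s t =
  (s ∈ᵇ leafLabels l ∧ t ∈ᵇ leafLabels l)
  ∨ (s ∈ᵇ leafLabels r ∧ t ∈ᵇ leafLabels r)
  ∨ (s ∈ᵇ leafLabels (node l r) ∧ t ∈ᵇ leafLabels (node l r)
       ∧ not (apparentDup (int l r)))

I : GeneForest → EdgeLabeledGraph
I F = record
  { V    = forestLabels F
  ; m    = length (forestInternals F)
  ; edge = λ a s t → edgeCond (lookup (forestInternals F) a) s t
  }

-- A subset X ⊆ V is given by a boolean predicate on labels (only its values
-- on V matter).
VSubset : Set
VSubset = ℕ → Bool

_∪ˢ_ : VSubset → VSubset → VSubset
(A ∪ˢ B) s = A s ∨ B s

_∩ˢ_ : VSubset → VSubset → VSubset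
(A ∩ˢ B) s = A s ∧ B s

cutSet : (H : EdgeLabeledGraph) → VSubset → ℕ
cutSet H X = ∣ tabulate crosses ∣
  where
    open EdgeLabeledGraph H
    crosses : Fin m → Bool
    crosses a = any (λ s → X s ∧ any (λ t → not (X t) ∧ edge a s t) V) V

Submodular : (VSubset → ℕ) → Set
Submodular f = ∀ (A B : VSubset) → f A + f B ≥ f (A ∪ˢ B) + f (A ∩ˢ B)

-- The cut-set function of I(F) counts the internal vertices x whose label is crossed by X.
-- The edges labelled x join all pairs in L(x_l), all pairs in L(x_r) and, unless x is an
-- apparent duplication, all pairs in L(x); for a duplication the two cliques share a label.
-- Either way they form a connected graph on L(x), so X crosses the label x iff X splits L(x).
-- And X ↦ [X splits S] is submodular for every S: if A ∪ B and A ∩ B both split S, witnessed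
-- by t ∉ A ∪ B and s ∈ A ∩ B, then (s, t) splits S for both A and B. Sums of submodular
-- functions are submodular.
module Submission where

open import Defs
open import Algebra.Properties.CommutativeSemigroup using (interchange)
open import Data.Bool using (Bool; true; false; _∧_; _∨_; not; T)
open import Data.Bool.ListAction using (any)
open import Data.Bool.Properties using (T-∧; T-∨)
open import Data.Empty using (⊥-elim)
open import Data.Fin using (Fin) renaming (zero to fzero; suc to fsuc)
open import Data.Fin.Subset using (Subset; ∣_∣)
open import Data.List using (List; _∷_; lookup)
open import Data.List.Membership.Propositional using (_∈_; find; lose)
open import Data.List.Membership.Propositional.Properties using (∈-++⁺ˡ; ∈-++⁺ʳ; ∈-++⁻; ∈-lookup)
open import Data.List.Relation.Binary.Subset.Propositional using (_⊆_)
open import Data.List.Relation.Unary.Any using (here; there)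
import Data.List.Relation.Unary.Any as Any
open import Data.List.Relation.Unary.Any.Properties using (any⁺; any⁻)
open import Data.Nat using (ℕ; zero; suc; _+_; _≤_; z≤n; s≤s)
open import Data.Nat.Properties
  using (≡ᵇ⇒≡; ≡⇒≡ᵇ; ≤-refl; +-mono-≤; +-commutativeSemigroup; module ≤-Reasoning)
open import Data.Product using (_×_; _,_; proj₁; proj₂; ∃₂)
import Data.Product as Product
open import Data.Product.Function.NonDependent.Propositional using (_×-⇔_)
open import Data.Sum using (_⊎_; inj₁; inj₂; [_,_])
import Data.Sum as Sum
open import Data.Sum.Function.Propositional using (_⊎-⇔_)
open import Data.Unit using (tt)
open import Data.Vec using (_∷_; tabulate)
open import Function using (id; _∘_; _⇔_; mk⇔; Equivalence)
open import Function.Construct.Composition using (_⇔-∘_)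
open import Function.Construct.Identity using (⇔-id)
open import Relation.Binary.PropositionalEquality using (_≡_; refl)

open Equivalence using (to; from)

toℕ : Bool → ℕ
toℕ true  = 1
toℕ false = 0

toℕ≤1 : ∀ b → toℕ b ≤ 1
toℕ≤1 true  = s≤s z≤n
toℕ≤1 false = z≤n

∣x∷p∣≡toℕx+∣p∣ : ∀ {n} x (p : Subset n) → ∣ x ∷ p ∣ ≡ toℕ x + ∣ p ∣
∣x∷p∣≡toℕx+∣p∣ true  p = refl
∣x∷p∣≡toℕx+∣p∣ false p = refl

T-dichotomy : ∀ b → T b ⊎ T (not b)
T-dichotomy true  = inj₁ tt
T-dichotomy false = inj₂ tt

T-not-∨ : ∀ a b → T (not (a ∨ b)) → T (not a) × T (not b)
T-not-∨ false false _ = tt , tt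

T-not-∧ : ∀ a b → T (not (a ∧ b)) → T (not a) ⊎ T (not b)
T-not-∧ false b     _ = inj₁ tt
T-not-∧ true  false _ = inj₂ tt

T-∈ᵇ⇔∈ : ∀ {s xs} → T (s ∈ᵇ xs) ⇔ s ∈ xs
T-∈ᵇ⇔∈ {s} {xs} = mk⇔ (Any.map (λ {t} → ≡ᵇ⇒≡ s t) ∘ any⁻ _ xs)
                      (any⁺ _ ∘ Any.map (λ {t} → ≡⇒≡ᵇ s t))

toℕ-submodular : ∀ a b c d → (T c → T a ⊎ T b) → (T d → T a ⊎ T b) → (T c → T d → T a × T b) →
                 toℕ c + toℕ d ≤ toℕ a + toℕ b
toℕ-submodular a     b     false false _  _  _    = z≤n
toℕ-submodular true  true  c     d     _  _  _    = +-mono-≤ (toℕ≤1 c) (toℕ≤1 d)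
toℕ-submodular true  false true  true  _  _  both = ⊥-elim (proj₂ (both tt tt))
toℕ-submodular false true  true  true  _  _  both = ⊥-elim (proj₁ (both tt tt))
toℕ-submodular false false true  d     c⇒ _  _    = ⊥-elim ([ (λ ()) , (λ ()) ] (c⇒ tt))
toℕ-submodular false false false true  _  d⇒ _    = ⊥-elim ([ (λ ()) , (λ ()) ] (d⇒ tt))
toℕ-submodular true  false true  false _  _  _    = ≤-refl
toℕ-submodular true  false false true  _  _  _    = ≤-refl
toℕ-submodular false true  true  false _  _  _    = ≤-refl
toℕ-submodular false true  false true  _  _  _    = ≤-refl

∣tabulate∣-+-mono-≤ : ∀ {m} {f g h k : Fin m → Bool} →
                      (∀ i → toℕ (h i) + toℕ (k i) ≤ toℕ (f i) + toℕ (g i)) →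
                      ∣ tabulate h ∣ + ∣ tabulate k ∣ ≤ ∣ tabulate f ∣ + ∣ tabulate g ∣
∣tabulate∣-+-mono-≤ {zero} _ = z≤n
∣tabulate∣-+-mono-≤ {suc m} {f} {g} {h} {k} le = begin
  ∣ tabulate h ∣ + ∣ tabulate k ∣
    ≡⟨ splitHeads h k ⟩
  (toℕ (h fzero) + toℕ (k fzero)) + (∣ tabulate (h ∘ fsuc) ∣ + ∣ tabulate (k ∘ fsuc) ∣)
    ≤⟨ +-mono-≤ (le fzero) (∣tabulate∣-+-mono-≤ (le ∘ fsuc)) ⟩
  (toℕ (f fzero) + toℕ (g fzero)) + (∣ tabulate (f ∘ fsuc) ∣ + ∣ tabulate (g ∘ fsuc) ∣)
    ≡⟨ splitHeads f g ⟨
  ∣ tabulate f ∣ + ∣ tabulate g ∣ ∎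
  where
  open ≤-Reasoning
  splitHeads : ∀ (u v : Fin (suc m) → Bool) → ∣ tabulate u ∣ + ∣ tabulate v ∣ ≡
               (toℕ (u fzero) + toℕ (v fzero)) + (∣ tabulate (u ∘ fsuc) ∣ + ∣ tabulate (v ∘ fsuc) ∣)
  splitHeads u v rewrite ∣x∷p∣≡toℕx+∣p∣ (u fzero) (tabulate (u ∘ fsuc))
                       | ∣x∷p∣≡toℕx+∣p∣ (v fzero) (tabulate (v ∘ fsuc))
    = interchange +-commutativeSemigroup (toℕ (u fzero)) _ (toℕ (v fzero)) _

Splits : VSubset → List ℕ → Set
Splits X S = ∃₂ λ s t → s ∈ S × t ∈ S × T (X s) × T (not (X t))

module _ {A B : VSubset} {S : List ℕ} where

  splits-∪ : Splits (A ∪ˢ B) S → Splits A S ⊎ Splits B S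
  splits-∪ (s , t , s∈S , t∈S , s∈A∪B , t∉A∪B) with T-∨ .to s∈A∪B | T-not-∨ (A t) (B t) t∉A∪B
  ... | inj₁ s∈A | t∉A , _ = inj₁ (s , t , s∈S , t∈S , s∈A , t∉A)
  ... | inj₂ s∈B | _ , t∉B = inj₂ (s , t , s∈S , t∈S , s∈B , t∉B)

  splits-∩ : Splits (A ∩ˢ B) S → Splits A S ⊎ Splits B S
  splits-∩ (s , t , s∈S , t∈S , s∈A∩B , t∉A∩B) with T-∧ .to s∈A∩B | T-not-∧ (A t) (B t) t∉A∩B
  ... | s∈A , _ | inj₁ t∉A = inj₁ (s , t , s∈S , t∈S , s∈A , t∉A)
  ... | _ , s∈B | inj₂ t∉B = inj₂ (s , t , s∈S , t∈S , s∈B , t∉B)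

  splits-∪-∩ : Splits (A ∪ˢ B) S → Splits (A ∩ˢ B) S → Splits A S × Splits B S
  splits-∪-∩ (_ , t , _ , t∈S , _ , t∉A∪B) (s , _ , s∈S , _ , s∈A∩B , _)
    with T-∧ .to s∈A∩B | T-not-∨ (A t) (B t) t∉A∪B
  ... | s∈A , s∈B | t∉A , t∉B = (s , t , s∈S , t∈S , s∈A , t∉A) , (s , t , s∈S , t∈S , s∈B , t∉B)

splitIndicator-submodular : ∀ {S} (b : VSubset → Bool) → (∀ X → T (b X) ⇔ Splits X S) →
                            ∀ A B → toℕ (b (A ∪ˢ B)) + toℕ (b (A ∩ˢ B)) ≤ toℕ (b A) + toℕ (b B)
splitIndicator-submodular b b⇔ A B = toℕ-submodular (b A) (b B) (b (A ∪ˢ B)) (b (A ∩ˢ B))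
  (reflect ∘ splits-∪ ∘ b⇔ (A ∪ˢ B) .to)
  (reflect ∘ splits-∩ ∘ b⇔ (A ∩ˢ B) .to)
  (λ ∪-true ∩-true → Product.map (b⇔ A .from) (b⇔ B .from)
                       (splits-∪-∩ (b⇔ (A ∪ˢ B) .to ∪-true) (b⇔ (A ∩ˢ B) .to ∩-true)))
  where
  reflect : Splits A _ ⊎ Splits B _ → T (b A) ⊎ T (b B)
  reflect = Sum.map (b⇔ A .from) (b⇔ B .from)

-- The summand of cutSet, definitionally.
crossesᵇ : VSubset → List ℕ → (ℕ → ℕ → Bool) → Bool
crossesᵇ X V e = any (λ s → X s ∧ any (λ t → not (X t) ∧ e s t) V) V

Crosses : VSubset → List ℕ → (ℕ → ℕ → Set) → Set
Crosses X V E = ∃₂ λ s t → s ∈ V × t ∈ V × T (X s) × T (not (X t)) × E s t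

Crosses-mono : ∀ {X V W} {E E′ : ℕ → ℕ → Set} → V ⊆ W → (∀ {s t} → E s t → E′ s t) →
               Crosses X V E → Crosses X W E′
Crosses-mono V⊆W E⇒E′ (s , t , s∈V , t∈V , s∈X , t∉X , st) =
  s , t , V⊆W s∈V , V⊆W t∈V , s∈X , t∉X , E⇒E′ st

T-crossesᵇ⇔Crosses : ∀ {X V e} → T (crossesᵇ X V e) ⇔ Crosses X V (λ s t → T (e s t))
T-crossesᵇ⇔Crosses {X} {V} {e} = mk⇔ decode encode
  where
  decode : T (crossesᵇ X V e) → Crosses X V (λ s t → T (e s t))
  decode p with find (any⁻ _ V p)
  ... | s , s∈V , q with T-∧ .to q
  ... | s∈X , q′ with find (any⁻ _ V q′)
  ... | t , t∈V , r with T-∧ .to r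
  ... | t∉X , st = s , t , s∈V , t∈V , s∈X , t∉X , st
  encode : Crosses X V (λ s t → T (e s t)) → T (crossesᵇ X V e)
  encode (s , t , s∈V , t∈V , s∈X , t∉X , st) =
    any⁺ _ (lose s∈V (T-∧ .from (s∈X , any⁺ _ (lose t∈V (T-∧ .from (t∉X , st))))))

labels : Internal → List ℕ
labels (int l r) = leafLabels (node l r)

EdgeCond : Internal → ℕ → ℕ → Set
EdgeCond x@(int l r) s t = (s ∈ leafLabels l × t ∈ leafLabels l)
                         ⊎ (s ∈ leafLabels r × t ∈ leafLabels r)
                         ⊎ (s ∈ labels x × t ∈ labels x × T (not (apparentDup x)))

T-∈ᵇ-∧⇔ : ∀ {s xs b} → T (s ∈ᵇ xs ∧ b) ⇔ (s ∈ xs × T b)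
T-∈ᵇ-∧⇔ {s} {xs} = (T-∈ᵇ⇔∈ ×-⇔ ⇔-id _) ⇔-∘ T-∧ {s ∈ᵇ xs}

T-edgeCond⇔EdgeCond : ∀ x {s t} → T (edgeCond x s t) ⇔ EdgeCond x s t
T-edgeCond⇔EdgeCond (int l r) {s} {t} =
  ((pair ⊎-⇔ pair ⊎-⇔ triple) ⇔-∘ (⇔-id _ ⊎-⇔ T-∨ {pairᵇ (leafLabels r)}))
    ⇔-∘ T-∨ {pairᵇ (leafLabels l)}
  where
  pairᵇ : List ℕ → Bool
  pairᵇ xs = s ∈ᵇ xs ∧ t ∈ᵇ xs
  pair : ∀ {xs} → T (pairᵇ xs) ⇔ (s ∈ xs × t ∈ xs)
  pair = (⇔-id _ ×-⇔ T-∈ᵇ⇔∈) ⇔-∘ T-∈ᵇ-∧⇔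
  triple : ∀ {xs b} → T (s ∈ᵇ xs ∧ t ∈ᵇ xs ∧ b) ⇔ (s ∈ xs × t ∈ xs × T b)
  triple = (⇔-id _ ×-⇔ T-∈ᵇ-∧⇔) ⇔-∘ T-∈ᵇ-∧⇔

EdgeCond⇒∈labels : ∀ x {s t} → EdgeCond x s t → s ∈ labels x × t ∈ labels x
EdgeCond⇒∈labels (int l r) (inj₁ (s∈l , t∈l))        = ∈-++⁺ˡ s∈l , ∈-++⁺ˡ t∈l
EdgeCond⇒∈labels (int l r) (inj₂ (inj₁ (s∈r , t∈r))) = ∈-++⁺ʳ _ s∈r , ∈-++⁺ʳ _ t∈r
EdgeCond⇒∈labels (int l r) (inj₂ (inj₂ (s∈ , t∈ , _))) = s∈ , t∈

EdgeCond-common : ∀ {l r c u} → c ∈ leafLabels l → c ∈ leafLabels r → u ∈ labels (int l r) →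
                  EdgeCond (int l r) u c × EdgeCond (int l r) c u
EdgeCond-common {l} c∈l c∈r u∈ with ∈-++⁻ (leafLabels l) u∈
... | inj₁ u∈l = inj₁ (u∈l , c∈l) , inj₁ (c∈l , u∈l)
... | inj₂ u∈r = inj₂ (inj₁ (u∈r , c∈r)) , inj₂ (inj₁ (c∈r , u∈r))

Crosses⇒Splits : ∀ {X V} x → Crosses X V (EdgeCond x) → Splits X (labels x)
Crosses⇒Splits x (s , t , _ , _ , s∈X , t∉X , st) =
  let s∈ , t∈ = EdgeCond⇒∈labels x st in s , t , s∈ , t∈ , s∈X , t∉X

Splits⇒Crosses : ∀ {X} x → Splits X (labels x) → Crosses X (labels x) (EdgeCond x)
Splits⇒Crosses {X} x@(int l r) (s , t , s∈ , t∈ , s∈X , t∉X) with T-dichotomy (apparentDup x)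
... | inj₂ nonDup = s , t , s∈ , t∈ , s∈X , t∉X , inj₂ (inj₂ (s∈ , t∈ , nonDup))
... | inj₁ dup with find (any⁻ (_∈ᵇ leafLabels r) (leafLabels l) dup)
... | c , c∈l , c∈ᵇr with T-∈ᵇ⇔∈ .to c∈ᵇr | T-dichotomy (X c)
... | c∈r | inj₁ c∈X = c , t , ∈-++⁺ˡ c∈l , t∈ , c∈X , t∉X , proj₂ (EdgeCond-common {l} {r} c∈l c∈r t∈)
... | c∈r | inj₂ c∉X = s , c , s∈ , ∈-++⁺ˡ c∈l , s∈X , c∉X , proj₁ (EdgeCond-common {l} {r} c∈l c∈r s∈)

T-crossesᵇ⇔Splits : ∀ {V} x → labels x ⊆ V →
                     ∀ X → T (crossesᵇ X V (edgeCond x)) ⇔ Splits X (labels x)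
T-crossesᵇ⇔Splits {V} x x⊆V X = mk⇔
  (Crosses⇒Splits x ∘ Crosses-mono id (T-edgeCond⇔EdgeCond x .to) ∘ reflectCrosses .to)
  (reflectCrosses .from ∘ Crosses-mono x⊆V (T-edgeCond⇔EdgeCond x .from) ∘ Splits⇒Crosses x)
  where
  reflectCrosses : T (crossesᵇ X V (edgeCond x)) ⇔ Crosses X V (λ s t → T (edgeCond x s t))
  reflectCrosses = T-crossesᵇ⇔Crosses

labels-⊆-tree : ∀ {x} tree → x ∈ internals tree → labels x ⊆ leafLabels tree
labels-⊆-tree (node l r) (here refl) = id
labels-⊆-tree (node l r) (there x∈) with ∈-++⁻ (internals l) x∈
... | inj₁ x∈l = ∈-++⁺ˡ ∘ labels-⊆-tree l x∈l
... | inj₂ x∈r = ∈-++⁺ʳ (leafLabels l) ∘ labels-⊆-tree r x∈r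

labels-⊆-forest : ∀ {x} F → x ∈ forestInternals F → labels x ⊆ forestLabels F
labels-⊆-forest (tree ∷ F) x∈ with ∈-++⁻ (internals tree) x∈
... | inj₁ x∈tree = ∈-++⁺ˡ ∘ labels-⊆-tree tree x∈tree
... | inj₂ x∈F    = ∈-++⁺ʳ (leafLabels tree) ∘ labels-⊆-forest F x∈F

lemma5 : (F : GeneForest) → Submodular (cutSet (I F))
lemma5 F A B = ∣tabulate∣-+-mono-≤ λ a →
  let x = lookup (forestInternals F) a
  in  splitIndicator-submodular (λ X → crossesᵇ X (forestLabels F) (edgeCond x))
        (T-crossesᵇ⇔Splits x (labels-⊆-forest F (∈-lookup a))) A B
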